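{- Let $q$ be a complex number, $q\neq 1$, that is not a root of unity. Define the sequence $(a_k)_{k\ge0}$ by $a_0=0$ and, recursively for $n\ge1$, \[\sum_{k=1}^n a_k\,q^{n-k}\binom{n-1}{k-1}_q=\frac{1}{[n]_q}=\frac{1-q}{1-q^n}.\] Then for every $n\ge 1$, \[H_{n,q}^1=\sum_{k=1}^n\binom{n}{k}_q a_k,\qquad\text{where } H_{n,q}^1=\sum_{k=1}^n\frac{1}{[k]_q}.\]
   Context: $[n]_q=\frac{1-q^n}{1-q}$, $[n]_q!=[n]_q[n-1]_q\cdots[1]_q$ (with $[0]_q!=1$), and the $q$-binomial coefficient is $\binom{n}{k}_q=\frac{[n]_q!}{[k]_q![n-k]_q!}$ for $n\ge k\ge 0$. -}

module Defs where

open import Level using (suc; _⊔_)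
open import Data.Nat using (ℕ; zero; _∸_) renaming (suc to sucℕ)
open import Relation.Nullary using (¬_)
open import Algebra.Bundles using (CommutativeRing)

record Field (c ℓ : Level.Level) : Set (Level.suc (c ⊔ ℓ)) where
  field
    commutativeRing : CommutativeRing c ℓ
  open CommutativeRing commutativeRing public
  field
    _⁻¹      : Carrier → Carrier
    ⁻¹-cong  : ∀ {x y} → x ≈ y → x ⁻¹ ≈ y ⁻¹
    0≉1      : ¬ (0# ≈ 1#)
    inverseʳ : ∀ x → ¬ (x ≈ 0#) → x * (x ⁻¹) ≈ 1#

module FieldDefs {c ℓ} (F : Field c ℓ) where
  open Field F public

  infixr 8 _^_
  _^_ : Carrier → ℕ → Carrier
  x ^ zero = 1#
  x ^ sucℕ n = x * (x ^ n)

  infixl 7 _/_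
  _/_ : Carrier → Carrier → Carrier
  x / y = x * (y ⁻¹)

  Σ[1…_] : ℕ → (ℕ → Carrier) → Carrier
  Σ[1… zero ] f = 0#
  Σ[1… sucℕ n ] f = Σ[1… n ] f + f (sucℕ n)

  [_]_ : ℕ → Carrier → Carrier
  [ n ] q = (1# - q ^ n) / (1# - q)

  [_]!_ : ℕ → Carrier → Carrier
  [ zero ]! q = 1#
  [ sucℕ n ]! q = [ sucℕ n ] q * [ n ]! q

  -- q-binomial coefficient (n choose k)_q = [n]_q! / ([k]_q! [n-k]_q!), used for n ≥ k
  qbinom : Carrier → ℕ → ℕ → Carrier
  qbinom q n k = [ n ]! q / ([ k ]! q * [ n ∸ k ]! q)

  H¹ : ℕ → Carrier → Carrier
  H¹ n q = Σ[1… n ] (λ k → 1# / [ k ] q)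

-- Let C(n, k) be the q-binomials given by the q-Pascal rule
-- C(n+1, k+1) = q^(n-k) C(n, k) + C(n, k+1).  For every q they satisfy
-- [j+r]! = C(j+r, j) [j]! [r]!, so they agree with the factorial formula as
-- soon as no [m]_q vanishes, i.e. when q is not a root of unity.
-- Splitting S n = Σ_{k=1}^n C(n, k) a k by the Pascal rule gives
-- S (n+1) = S n + Σ_{k=1}^{n+1} a k q^(n+1-k) C(n, k-1) = S n + 1/[n+1]_q,
-- so S n telescopes to H¹ n q.
module Submission where

open import Defs
open import Data.Nat using (ℕ; zero; _∸_; _≥_; _≤_; _<_; z≤n; s≤s)
  renaming (suc to sucℕ; _+_ to _+ℕ_)
open import Data.Nat.Properties
  using (+-suc; n∸n≡0; m+n∸m≡n; m+[n∸m]≡n; m≤n⇒m≤1+n; m<n⇒m<1+n; n<1+n; ∸-monoˡ-≤)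
  renaming (+-identityʳ to ℕ-+-identityʳ)
open import Relation.Binary.PropositionalEquality using (cong; subst) renaming (sym to sym≡)
open import Relation.Nullary using (¬_)
import Algebra.Solver.CommutativeMonoid as CommutativeMonoidSolver

module FieldLemmas {c ℓ} (F : Field c ℓ) where
  open FieldDefs F
  open import Relation.Binary.Reasoning.Setoid setoid
  open import Algebra.Properties.Ring ring using (x[y-z]≈xy-xz)
  private
    module *-Solver = CommutativeMonoidSolver *-commutativeMonoid
    module +-Solver = CommutativeMonoidSolver +-commutativeMonoid
    open *-Solver using (_⊜_) renaming (_⊕_ to _⊗_)
    open +-Solver using () renaming (_⊕_ to _⊞_; _⊜_ to _⊜⁺_)

  x≉0∧y≉0⇒x*y≉0 : ∀ {x y} → ¬ (x ≈ 0#) → ¬ (y ≈ 0#) → ¬ (x * y ≈ 0#)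
  x≉0∧y≉0⇒x*y≉0 {x} {y} x≉0 y≉0 xy≈0 = y≉0 (begin
    y               ≈⟨ sym (*-identityˡ y) ⟩
    1# * y          ≈⟨ *-congʳ (sym (inverseʳ x x≉0)) ⟩
    x * x ⁻¹ * y    ≈⟨ *-Solver.solve 3 (λ x x⁻¹ y → (x ⊗ x⁻¹) ⊗ y ⊜ x⁻¹ ⊗ (x ⊗ y)) refl x (x ⁻¹) y ⟩
    x ⁻¹ * (x * y)  ≈⟨ *-congˡ xy≈0 ⟩
    x ⁻¹ * 0#       ≈⟨ zeroʳ _ ⟩
    0#              ∎)

  x≉0⇒x⁻¹≉0 : ∀ {x} → ¬ (x ≈ 0#) → ¬ (x ⁻¹ ≈ 0#)
  x≉0⇒x⁻¹≉0 {x} x≉0 x⁻¹≈0 = 0≉1 (begin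
    0#        ≈⟨ sym (zeroʳ x) ⟩
    x * 0#    ≈⟨ *-congˡ (sym x⁻¹≈0) ⟩
    x * x ⁻¹  ≈⟨ inverseʳ x x≉0 ⟩
    1#        ∎)

  x≉1⇒1-x≉0 : ∀ {x} → ¬ (x ≈ 1#) → ¬ (1# - x ≈ 0#)
  x≉1⇒1-x≉0 {x} x≉1 1-x≈0 = x≉1 (begin
    x               ≈⟨ sym (+-identityˡ x) ⟩
    0# + x          ≈⟨ +-congʳ (sym 1-x≈0) ⟩
    1# - x + x      ≈⟨ +-assoc _ _ _ ⟩
    1# + (- x + x)  ≈⟨ +-congˡ (-‿inverseˡ x) ⟩
    1# + 0#         ≈⟨ +-identityʳ _ ⟩
    1#              ∎)

  x≈z*y⇒x/y≈z : ∀ {x y z} → ¬ (y ≈ 0#) → x ≈ z * y → x / y ≈ z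
  x≈z*y⇒x/y≈z {x} {y} {z} y≉0 x≈zy = begin
    x * y ⁻¹      ≈⟨ *-congʳ x≈zy ⟩
    z * y * y ⁻¹  ≈⟨ *-assoc _ _ _ ⟩
    z * (y * y ⁻¹) ≈⟨ *-congˡ (inverseʳ y y≉0) ⟩
    z * 1#        ≈⟨ *-identityʳ z ⟩
    z             ∎

  1-xy≈y[1-x]+[1-y] : ∀ x y → 1# - x * y ≈ y * (1# - x) + (1# - y)
  1-xy≈y[1-x]+[1-y] x y = sym (begin
    y * (1# - x) + (1# - y)      ≈⟨ +-congʳ (x[y-z]≈xy-xz y 1# x) ⟩
    (y * 1# - y * x) + (1# - y)  ≈⟨ +-congʳ (+-congʳ (*-identityʳ y)) ⟩
    (y - y * x) + (1# - y)
      ≈⟨ +-Solver.solve 4 (λ y -yx 1# -y → (y ⊞ -yx) ⊞ (1# ⊞ -y) ⊜⁺ (y ⊞ -y) ⊞ (1# ⊞ -yx))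
                          refl y (- (y * x)) 1# (- y) ⟩
    (y - y) + (1# - y * x)       ≈⟨ +-congʳ (-‿inverseʳ y) ⟩
    0# + (1# - y * x)            ≈⟨ +-identityˡ _ ⟩
    1# - y * x                   ≈⟨ +-congˡ (-‿cong (*-comm y x)) ⟩
    1# - x * y                   ∎)

  Σ[1…]-cong : ∀ n {f g : ℕ → Carrier} → (∀ k → 1 ≤ k → k ≤ n → f k ≈ g k) →
               Σ[1… n ] f ≈ Σ[1… n ] g
  Σ[1…]-cong zero     f≈g = refl
  Σ[1…]-cong (sucℕ n) f≈g =
    +-cong (Σ[1…]-cong n (λ k 1≤k k≤n → f≈g k 1≤k (m≤n⇒m≤1+n k≤n))) (f≈g (sucℕ n) (s≤s z≤n) (n<1+n n))

  Σ[1…]-distrib-+ : ∀ n (f g : ℕ → Carrier) →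
                    Σ[1… n ] (λ k → f k + g k) ≈ Σ[1… n ] f + Σ[1… n ] g
  Σ[1…]-distrib-+ zero     f g = sym (+-identityˡ _)
  Σ[1…]-distrib-+ (sucℕ n) f g = begin
    Σ[1… n ] (λ k → f k + g k) + (f (sucℕ n) + g (sucℕ n))  ≈⟨ +-congʳ (Σ[1…]-distrib-+ n f g) ⟩
    (Σ[1… n ] f + Σ[1… n ] g) + (f (sucℕ n) + g (sucℕ n))
      ≈⟨ +-Solver.solve 4 (λ a b c d → (a ⊞ b) ⊞ (c ⊞ d) ⊜⁺ (a ⊞ c) ⊞ (b ⊞ d)) refl _ _ _ _ ⟩
    (Σ[1… n ] f + f (sucℕ n)) + (Σ[1… n ] g + g (sucℕ n))   ∎

module QNumbers {c ℓ} (F : Field c ℓ) (q : Field.Carrier F) where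
  open FieldDefs F
  open FieldLemmas F
  open import Relation.Binary.Reasoning.Setoid setoid
  private
    module *-Solver = CommutativeMonoidSolver *-commutativeMonoid
    open *-Solver using (_⊜_) renaming (_⊕_ to _⊗_)

  ^-distribˡ-+-* : ∀ m n → q ^ (m +ℕ n) ≈ q ^ m * q ^ n
  ^-distribˡ-+-* zero     n = sym (*-identityˡ _)
  ^-distribˡ-+-* (sucℕ m) n = trans (*-congˡ (^-distribˡ-+-* m n)) (sym (*-assoc _ _ _))

  [m+n]≈qⁿ[m]+[n] : ∀ m n → [ m +ℕ n ] q ≈ q ^ n * [ m ] q + [ n ] q
  [m+n]≈qⁿ[m]+[n] m n = begin
    (1# - q ^ (m +ℕ n)) * u                      ≈⟨ *-congʳ (+-congˡ (-‿cong (^-distribˡ-+-* m n))) ⟩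
    (1# - q ^ m * q ^ n) * u                     ≈⟨ *-congʳ (1-xy≈y[1-x]+[1-y] (q ^ m) (q ^ n)) ⟩
    (q ^ n * (1# - q ^ m) + (1# - q ^ n)) * u    ≈⟨ distribʳ u _ _ ⟩
    q ^ n * (1# - q ^ m) * u + (1# - q ^ n) * u  ≈⟨ +-congʳ (*-assoc _ _ _) ⟩
    q ^ n * [ m ] q + [ n ] q                    ∎
    where u = (1# - q) ⁻¹

  qpascal : ℕ → ℕ → Carrier
  qpascal n        zero     = 1#
  qpascal zero     (sucℕ k) = 0#
  qpascal (sucℕ n) (sucℕ k) = q ^ (n ∸ k) * qpascal n k + qpascal n (sucℕ k)

  n<k⇒qpascal≈0 : ∀ {n k} → n < k → qpascal n k ≈ 0#
  n<k⇒qpascal≈0 {zero}   {sucℕ k} _         = refl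
  n<k⇒qpascal≈0 {sucℕ n} {sucℕ k} (s≤s n<k) = begin
    q ^ (n ∸ k) * qpascal n k + qpascal n (sucℕ k)
      ≈⟨ +-cong (*-congˡ (n<k⇒qpascal≈0 n<k)) (n<k⇒qpascal≈0 (m<n⇒m<1+n n<k)) ⟩
    q ^ (n ∸ k) * 0# + 0#  ≈⟨ +-identityʳ _ ⟩
    q ^ (n ∸ k) * 0#       ≈⟨ zeroʳ _ ⟩
    0#                     ∎

  qpascal-diag : ∀ n → qpascal n n ≈ 1#
  qpascal-diag zero     = refl
  qpascal-diag (sucℕ n) = begin
    q ^ (n ∸ n) * qpascal n n + qpascal n (sucℕ n)
      ≈⟨ +-cong (*-cong (reflexive (cong (q ^_) (n∸n≡0 n))) (qpascal-diag n)) (n<k⇒qpascal≈0 (n<1+n n)) ⟩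
    1# * 1# + 0#  ≈⟨ +-identityʳ _ ⟩
    1# * 1#       ≈⟨ *-identityʳ _ ⟩
    1#            ∎

  [j+r]!≈qpascal*[j]![r]! : ∀ j r → [ j +ℕ r ]! q ≈ qpascal (j +ℕ r) j * ([ j ]! q * [ r ]! q)
  [j+r]!≈qpascal*[j]![r]! zero     r = sym (trans (*-identityˡ _) (*-identityˡ _))
  [j+r]!≈qpascal*[j]![r]! (sucℕ j) zero rewrite ℕ-+-identityʳ j = sym (begin
    qpascal (sucℕ j) (sucℕ j) * ([ sucℕ j ]! q * 1#)  ≈⟨ *-cong (qpascal-diag (sucℕ j)) (*-identityʳ _) ⟩
    1# * [ sucℕ j ]! q                                ≈⟨ *-identityˡ _ ⟩
    [ sucℕ j ]! q                                     ∎)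
  [j+r]!≈qpascal*[j]![r]! (sucℕ j) (sucℕ r) = begin
    [ sucℕ j +ℕ sucℕ r ] q * [ n ]! q            ≈⟨ *-congʳ ([m+n]≈qⁿ[m]+[n] (sucℕ j) (sucℕ r)) ⟩
    (qʳ⁺¹ * [j+1] + [r+1]) * [ n ]! q            ≈⟨ distribʳ _ _ _ ⟩
    qʳ⁺¹ * [j+1] * [ n ]! q + [r+1] * [ n ]! q   ≈⟨ +-cong (*-congˡ split-off-j) (*-congˡ split-off-j+1) ⟩
    qʳ⁺¹ * [j+1] * (qpascal n j * ([ j ]! q * ([r+1] * [ r ]! q)))
      + [r+1] * (qpascal n (sucℕ j) * (([j+1] * [ j ]! q) * [ r ]! q))
      ≈⟨ +-cong (*-Solver.solve 6 (λ Q J R C j! r! → (Q ⊗ J) ⊗ (C ⊗ (j! ⊗ (R ⊗ r!))) ⊜ (Q ⊗ C) ⊗ ((J ⊗ j!) ⊗ (R ⊗ r!)))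
                                   refl qʳ⁺¹ [j+1] [r+1] (qpascal n j) ([ j ]! q) ([ r ]! q))
                (*-Solver.solve 5 (λ J R C j! r! → R ⊗ (C ⊗ ((J ⊗ j!) ⊗ r!)) ⊜ C ⊗ ((J ⊗ j!) ⊗ (R ⊗ r!)))
                                   refl [j+1] [r+1] (qpascal n (sucℕ j)) ([ j ]! q) ([ r ]! q)) ⟩
    qʳ⁺¹ * qpascal n j * ([j+1]! * [r+1]!) + qpascal n (sucℕ j) * ([j+1]! * [r+1]!)  ≈⟨ sym (distribʳ _ _ _) ⟩
    (qʳ⁺¹ * qpascal n j + qpascal n (sucℕ j)) * ([j+1]! * [r+1]!)
      ≈⟨ *-congʳ (+-congʳ (*-congʳ (reflexive (cong (q ^_) (sym≡ (m+n∸m≡n j (sucℕ r))))))) ⟩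
    qpascal (sucℕ j +ℕ sucℕ r) (sucℕ j) * ([j+1]! * [r+1]!)  ∎
    where
    n = j +ℕ sucℕ r
    qʳ⁺¹ = q ^ sucℕ r
    [j+1] = [ sucℕ j ] q
    [r+1] = [ sucℕ r ] q
    [j+1]! = [ sucℕ j ]! q
    [r+1]! = [ sucℕ r ]! q
    split-off-j : [ n ]! q ≈ qpascal n j * ([ j ]! q * [r+1]!)
    split-off-j = [j+r]!≈qpascal*[j]![r]! j (sucℕ r)
    split-off-j+1 : [ n ]! q ≈ qpascal n (sucℕ j) * ([j+1]! * [ r ]! q)
    split-off-j+1 = subst (λ m → [ m ]! q ≈ qpascal m (sucℕ j) * ([j+1]! * [ r ]! q))
                          (sym≡ (+-suc j r)) ([j+r]!≈qpascal*[j]![r]! (sucℕ j) r)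

  Σqpascal[1+n]*a≈Σa*qpascal[n]+Σqpascal[n]*a : ∀ n (a : ℕ → Carrier) →
    Σ[1… sucℕ n ] (λ k → qpascal (sucℕ n) k * a k)
      ≈ Σ[1… sucℕ n ] (λ k → a k * q ^ (sucℕ n ∸ k) * qpascal n (k ∸ 1)) + Σ[1… n ] (λ k → qpascal n k * a k)
  Σqpascal[1+n]*a≈Σa*qpascal[n]+Σqpascal[n]*a n a = begin
    Σ[1… sucℕ n ] (λ k → qpascal (sucℕ n) k * a k)  ≈⟨ Σ[1…]-cong (sucℕ n) pascal-rule ⟩
    Σ[1… sucℕ n ] (λ k → shifted k + qpascal n k * a k)  ≈⟨ Σ[1…]-distrib-+ (sucℕ n) shifted _ ⟩
    Σ[1… sucℕ n ] shifted + (Σ[1… n ] (λ k → qpascal n k * a k) + qpascal n (sucℕ n) * a (sucℕ n))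
      ≈⟨ +-congˡ (+-congˡ (trans (*-congʳ (n<k⇒qpascal≈0 (n<1+n n))) (zeroˡ _))) ⟩
    Σ[1… sucℕ n ] shifted + (Σ[1… n ] (λ k → qpascal n k * a k) + 0#)  ≈⟨ +-congˡ (+-identityʳ _) ⟩
    Σ[1… sucℕ n ] shifted + Σ[1… n ] (λ k → qpascal n k * a k)  ∎
    where
    shifted : ℕ → Carrier
    shifted k = a k * q ^ (sucℕ n ∸ k) * qpascal n (k ∸ 1)
    pascal-rule : ∀ k → 1 ≤ k → k ≤ sucℕ n → qpascal (sucℕ n) k * a k ≈ shifted k + qpascal n k * a k
    pascal-rule (sucℕ k) _ _ = trans (distribʳ _ _ _)
      (+-congʳ (*-Solver.solve 3 (λ Q C x → (Q ⊗ C) ⊗ x ⊜ (x ⊗ Q) ⊗ C) refl _ _ _))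

  H¹≈Σqpascal*a : (a : ℕ → Carrier) →
    (∀ n → Σ[1… sucℕ n ] (λ k → a k * q ^ (sucℕ n ∸ k) * qpascal n (k ∸ 1)) ≈ 1# / [ sucℕ n ] q) →
    ∀ n → H¹ n q ≈ Σ[1… n ] (λ k → qpascal n k * a k)
  H¹≈Σqpascal*a a rec zero     = refl
  H¹≈Σqpascal*a a rec (sucℕ n) = begin
    H¹ n q + 1# / [ sucℕ n ] q  ≈⟨ +-comm _ _ ⟩
    1# / [ sucℕ n ] q + H¹ n q  ≈⟨ +-cong (sym (rec n)) (H¹≈Σqpascal*a a rec n) ⟩
    Σ[1… sucℕ n ] (λ k → a k * q ^ (sucℕ n ∸ k) * qpascal n (k ∸ 1)) + Σ[1… n ] (λ k → qpascal n k * a k)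
      ≈⟨ sym (Σqpascal[1+n]*a≈Σa*qpascal[n]+Σqpascal[n]*a n a) ⟩
    Σ[1… sucℕ n ] (λ k → qpascal (sucℕ n) k * a k)  ∎

  module NotRootOfUnity (q≉1 : ¬ (q ≈ 1#)) (qᵐ≉1 : ∀ m → m ≥ 1 → ¬ (q ^ m ≈ 1#)) where
    [1+m]≉0 : ∀ m → ¬ ([ sucℕ m ] q ≈ 0#)
    [1+m]≉0 m = x≉0∧y≉0⇒x*y≉0 (x≉1⇒1-x≉0 (qᵐ≉1 (sucℕ m) (s≤s z≤n))) (x≉0⇒x⁻¹≉0 (x≉1⇒1-x≉0 q≉1))

    [n]!≉0 : ∀ n → ¬ ([ n ]! q ≈ 0#)
    [n]!≉0 zero     1≈0 = 0≉1 (sym 1≈0)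
    [n]!≉0 (sucℕ n) = x≉0∧y≉0⇒x*y≉0 ([1+m]≉0 n) ([n]!≉0 n)

    qbinom≈qpascal : ∀ {n k} → k ≤ n → qbinom q n k ≈ qpascal n k
    qbinom≈qpascal {n} {k} k≤n = subst (λ m → qbinom q m k ≈ qpascal m k) (m+[n∸m]≡n k≤n) qbinom[k+r]≈qpascal
      where
      r = n ∸ k
      qbinom[k+r]≈qpascal : qbinom q (k +ℕ r) k ≈ qpascal (k +ℕ r) k
      qbinom[k+r]≈qpascal rewrite m+n∸m≡n k r =
        x≈z*y⇒x/y≈z (x≉0∧y≉0⇒x*y≉0 ([n]!≉0 k) ([n]!≉0 r)) ([j+r]!≈qpascal*[j]![r]! k r)

proposition3 : ∀ {c ℓ} (F : Field c ℓ) → let open FieldDefs F in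
    (q : Carrier) → ¬ (q ≈ 1#) → (∀ (m : ℕ) → m ≥ 1 → ¬ (q ^ m ≈ 1#)) →
    (a : ℕ → Carrier) → a 0 ≈ 0# →
    (∀ (n : ℕ) → n ≥ 1 →
    Σ[1… n ] (λ k → a k * (q ^ (n ∸ k)) * qbinom q (n ∸ 1) (k ∸ 1)) ≈ 1# / [ n ] q) →
    ∀ (n : ℕ) → n ≥ 1 → H¹ n q ≈ Σ[1… n ] (λ k → qbinom q n k * a k)
proposition3 F q q≉1 qᵐ≉1 a _ rec n _ = begin
  H¹ n q                                    ≈⟨ H¹≈Σqpascal*a a pascal-rec n ⟩
  Σ[1… n ] (λ k → qpascal n k * a k)        ≈⟨ Σ[1…]-cong n (λ k _ k≤n → *-congʳ (sym (qbinom≈qpascal k≤n))) ⟩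
  Σ[1… n ] (λ k → qbinom q n k * a k)       ∎
  where
  open FieldDefs F
  open FieldLemmas F
  open QNumbers F q
  open NotRootOfUnity q≉1 qᵐ≉1
  open import Relation.Binary.Reasoning.Setoid setoid
  pascal-rec : ∀ n → Σ[1… sucℕ n ] (λ k → a k * q ^ (sucℕ n ∸ k) * qpascal n (k ∸ 1)) ≈ 1# / [ sucℕ n ] q
  pascal-rec n = trans (Σ[1…]-cong (sucℕ n) (λ k _ k≤1+n → *-congˡ (sym (qbinom≈qpascal (∸-monoˡ-≤ 1 k≤1+n)))))
                       (rec (sucℕ n) (s≤s z≤n))
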